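{- Let $(I,=_I,\neq_I;K)$ be a discrete completely separated set and $S=(\lambda_0,\lambda_1;\phi_0,\phi_1)$ a family of completely separated sets indexed by it. For $k\in K$ let $\widehat k:\sum_{i\in I}\lambda_0(i)\to\mathbb R$, $\widehat k(i,x):=k(i)$, and $\widehat K:=\{\widehat k\mid k\in K\}$; for $\Phi\in\prod_{i\in I}F_i$ let $\widehat\Phi(i,x):=\Phi_i(x)$ and $\widehat H:=\{\widehat\Phi\mid\Phi\in\prod_{i\in I}F_i\}$. (i) For all $(i,x),(j,y)\in\sum_{i\in I}\lambda_0(i)$: if $(i,x)\neq_{(\sum,\widehat K\cup\widehat H)}(j,y)$ then $(i,x)\neq_{\sum_{i\in I}\lambda_0(i)}(j,y)$. (ii) If for every $j\in I$ and every $h\in F_j$ there is $\Phi\in\prod_{i\in I}F_i$ with $\Phi_j=_{\mathbb F(\lambda_0(j))}h$, then for all $(i,x),(j,y)$: $(i,x)\neq_{\sum_{i\in I}\lambda_0(i)}(j,y)$ implies $(i,x)\neq_{(\sum,\widehat K\cup\widehat H)}(j,y)$.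
   Context: Constructive (Bishop-style) setting. $\mathbb F(X)$ is the set of real-valued functions with pointwise equality; extensional subsets are given by equality-stable properties; $a\neq_{\mathbb R}b$ iff $|a-b|>0$. For extensional $F\subseteq\mathbb F(X)$: $x=_{(X,F)}x'$ iff $\forall f\in F\,f(x)=f(x')$; $x\neq_{(X,F)}x'$ iff $\exists f\in F\,f(x)\neq_{\mathbb R}f(x')$. A set with an inequality $(X,=_X,\neq_X)$ has $x=_Xy$, $x\neq_Xy$ contradictory; it is discrete if $x=_Xy\vee x\neq_Xy$ for all $x,y$. Strongly extensional: $f(x)\neq f(y)\Rightarrow x\neq y$. A completely separated set $(X,=_X,\neq_X;F)$: $\neq_X\Leftrightarrow\neq_{(X,F)}$ and $x=_{(X,F)}x'\Rightarrow x=_Xx'$. A family of completely separated sets indexed by $(I,=_I,\neq_I;K)$: for each $i$ a set with an inequality $\lambda_0(i)$ and an extensional $F_i\subseteq\mathbb F(\lambda_0(i))$; for $i=_Ij$ a strongly extensional $\lambda_{ij}:\lambda_0(i)\to\lambda_0(j)$ ($\lambda_{ii}=\mathrm{id}$, $\lambda_{jk}\circ\lambda_{ij}=\lambda_{ik}$) and $\phi_{ij}:F_i\to F_j$; with $\neq_{\lambda_0(i)}\Leftrightarrow\neq_{(\lambda_0(i),F_i)}$, $=_{(\lambda_0(i),F_i)}\Rightarrow=_{\lambda_0(i)}$, and $\phi_{ij}(f)=f\circ\lambda_{ji}$. The Sigma-set $\sum_{i\in I}\lambda_0(i)$: pairs $(i,x)$, $x\in\lambda_0(i)$, with $(i,x)=(j,y)$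 iff $i=_Ij$ and $\lambda_{ij}(x)=y$, and $(i,x)\neq(j,y)$ iff $i\neq_Ij$ or ($i=_Ij$ and $\lambda_{ij}(x)\neq_{\lambda_0(j)}y$). The Pi-set $\prod_{i\in I}F_i$ consists of dependent assignments $\Phi$ with $\Phi_i\in F_i$ and $\Phi_j=\phi_{ij}(\Phi_i)$ whenever $i=_Ij$ (pointwise equality). -}

module Defs where

open import Data.Nat as ℕ using (ℕ; suc)
open import Data.Integer using (+_)
open import Data.Rational using (ℚ; _/_; _+_; _-_; ∣_∣; _≤_; _<_)
open import Data.Product using (Σ; Σ-syntax; _×_; _,_)
open import Data.Sum using (_⊎_)
open import Data.Empty using (⊥)
open import Relation.Binary.Structures using (IsEquivalence)

-- Bishop reals: regular sequences of rationals (index n stands for n+1)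

record ℝ : Set where
  field
    seq : ℕ → ℚ
    reg : ∀ m n → ∣ seq m - seq n ∣ ≤ ((+ 1) / suc m) + ((+ 1) / suc n)
open ℝ public

_=ℝ_ : ℝ → ℝ → Set
x =ℝ y = ∀ n → ∣ seq x n - seq y n ∣ ≤ (+ 2) / suc n

-- a ≠ℝ b  iff  |a - b| > 0, where (|a-b|)_n = |a_{2n} - b_{2n}| and
-- z > 0 iff ∃ n ≥ 1, z_n > 1/n   (0-based: index 2n+1)
_≠ℝ_ : ℝ → ℝ → Set
a ≠ℝ b = Σ[ n ∈ ℕ ] ((+ 1) / suc n < ∣ seq a (suc (2 ℕ.* n)) - seq b (suc (2 ℕ.* n)) ∣)

record SetIneq : Set₁ where
  field
    Car   : Set
    _≈_   : Car → Car → Set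
    _≉_   : Car → Car → Set
    isEq  : IsEquivalence _≈_
    contr : ∀ {x y} → x ≈ y → x ≉ y → ⊥
open SetIneq public

Discrete : SetIneq → Set
Discrete X = ∀ x y → _≈_ X x y ⊎ _≉_ X x y

record Fn (X : SetIneq) : Set where
  field
    ap  : Car X → ℝ
    ext : ∀ {x y} → _≈_ X x y → ap x =ℝ ap y
open Fn public

_=𝔽_ : {X : SetIneq} → Fn X → Fn X → Set
_=𝔽_ {X} f g = ∀ (x : Car X) → ap f x =ℝ ap g x

record ExtSubset (X : SetIneq) : Set₁ where
  field
    mem    : Fn X → Set
    stable : ∀ {f g} → f =𝔽 g → mem f → mem g
open ExtSubset public

Elem : {X : SetIneq} → ExtSubset X → Set
Elem {X} F = Σ[ f ∈ Fn X ] mem F f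

_=[_]_ : {X : SetIneq} → Car X → ExtSubset X → Car X → Set
x =[ F ] x' = ∀ f → mem F f → ap f x =ℝ ap f x'

_≠[_]_ : {X : SetIneq} → Car X → ExtSubset X → Car X → Set
_≠[_]_ {X} x F x' = Σ[ f ∈ Fn X ] (mem F f × (ap f x ≠ℝ ap f x'))

CompletelySeparated : (X : SetIneq) → ExtSubset X → Set
CompletelySeparated X F =
  (∀ x y → (_≉_ X x y → x ≠[ F ] y) × (x ≠[ F ] y → _≉_ X x y))
  × (∀ x y → x =[ F ] y → _≈_ X x y)

record Family (I : SetIneq) (K : ExtSubset I) : Set₁ where
  field
    λ₀ : Car I → SetIneq
    F  : (i : Car I) → ExtSubset (λ₀ i)
    λ₁ : ∀ {i j} → _≈_ I i j → Car (λ₀ i) → Car (λ₀ j)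
    λ₁-ext : ∀ {i j} (p : _≈_ I i j) {x y} →
             _≈_ (λ₀ i) x y → _≈_ (λ₀ j) (λ₁ p x) (λ₁ p y)
    λ₁-strext : ∀ {i j} (p : _≈_ I i j) x y →
             _≉_ (λ₀ j) (λ₁ p x) (λ₁ p y) → _≉_ (λ₀ i) x y
    λ₁-id : ∀ {i} (p : _≈_ I i i) x → _≈_ (λ₀ i) (λ₁ p x) x
    λ₁-comp : ∀ {i j k} (p : _≈_ I i j) (q : _≈_ I j k) (r : _≈_ I i k) x →
             _≈_ (λ₀ k) (λ₁ q (λ₁ p x)) (λ₁ r x)
    φ₁ : ∀ {i j} → _≈_ I i j → Elem (F i) → Elem (F j)
    φ₁-def : ∀ {i j} (p : _≈_ I i j) (f : Elem (F i)) (y : Car (λ₀ j)) →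
             ap (Σ.proj₁ (φ₁ p f)) y
               =ℝ ap (Σ.proj₁ f) (λ₁ (IsEquivalence.sym (isEq I) p) y)
    compSep : ∀ i → CompletelySeparated (λ₀ i) (F i)
open Family public

module _ {I : SetIneq} {K : ExtSubset I} (S : Family I K) where

  ΣCar : Set
  ΣCar = Σ[ i ∈ Car I ] Car (λ₀ S i)

  _=Σ_ : ΣCar → ΣCar → Set
  (i , x) =Σ (j , y) = Σ[ p ∈ _≈_ I i j ] _≈_ (λ₀ S j) (λ₁ S p x) y

  _≠Σ_ : ΣCar → ΣCar → Set
  (i , x) ≠Σ (j , y) =
    _≉_ I i j ⊎ (Σ[ p ∈ _≈_ I i j ] _≉_ (λ₀ S j) (λ₁ S p x) y)

  record Π-set : Set where
    field
      Φ   : (i : Car I) → Elem (F S i)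
      dep : ∀ {i j} (p : _≈_ I i j) → Σ.proj₁ (Φ j) =𝔽 Σ.proj₁ (φ₁ S p (Φ i))
  open Π-set public

  hatK : Fn I → ΣCar → ℝ
  hatK k (i , x) = ap k i

  hatΦ : Π-set → ΣCar → ℝ
  hatΦ Φ' (i , x) = ap (Σ.proj₁ (Φ Φ' i)) x

  _≠KH_ : ΣCar → ΣCar → Set
  z ≠KH w =
    (Σ[ k ∈ Fn I ] (mem K k × (hatK k z ≠ℝ hatK k w)))
    ⊎ (Σ[ Φ' ∈ Π-set ] (hatΦ Φ' z ≠ℝ hatΦ Φ' w))

-- Within one fibre, Φ_i(x) and Φ_j(λ_ij x) are equal reals, because Φ is a dependent
-- assignment and λ_ji ∘ λ_ij is the identity up to equality.  So a section Φ separates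
-- (i,x) from (j,y) with i = j exactly when its component Φ_j separates λ_ij x from y in
-- λ₀(j), which by complete separatedness of the fibre means λ_ij x ≠ y; a function k̂
-- separates them exactly when k separates i from j in I.  Discreteness of I settles the
-- case split in (i); in (ii) a separating h ∈ F_j is replaced by a section through h.
-- The only analysis needed is that ≠ℝ respects =ℝ, which for Bishop reals is an
-- Archimedean estimate on the defining regular sequences.

module Submission where

open import Defs
open import Data.Product using (Σ; Σ-syntax; _×_; proj₁; proj₂; _,_)
open import Data.Sum using (inj₁; inj₂)
open import Data.Nat as ℕ using (ℕ; suc; zero)
import Data.Nat.Properties as ℕ
open import Data.Integer as ℤ using (+_; +[1+_]; -[1+_])
import Data.Integer.Properties as ℤ
open import Data.Rational using (ℚ; mkℚ; _/_; _+_; _-_; -_; ∣_∣; _≤_; _<_; 0ℚ; toℚᵘ; *<*)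
open import Data.Rational.Properties
import Data.Rational.Unnormalised as ℚᵘ
import Data.Rational.Unnormalised.Properties as ℚᵘ
open import Relation.Binary.Structures using (IsEquivalence)
open import Function.Bundles using (_⇔_; mk⇔; Equivalence)
open import Relation.Binary.PropositionalEquality
open import Data.Integer.Solver using (module +-*-Solver)
open import Data.Rational.Solver using (module +-*-Solver)

odd : ℕ → ℕ
odd n = suc (2 ℕ.* n)

frac : ℕ → ℕ → ℚ
frac a k = + a / suc k

frac≃ : ∀ a k → toℚᵘ (frac a k) ℚᵘ.≃ ℚᵘ.mkℚᵘ (+ a) k
frac≃ a k = toℚᵘ-fromℚᵘ (ℚᵘ.mkℚᵘ (+ a) k)

frac-+ : ∀ a b k → frac a k + frac b k ≡ frac (a ℕ.+ b) k
frac-+ a b k = toℚᵘ-injective (ℚᵘ.≃-trans (toℚᵘ-homo-+ (frac a k) (frac b k))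
  (ℚᵘ.≃-trans (ℚᵘ.+-cong (frac≃ a k) (frac≃ b k))
  (ℚᵘ.≃-trans (ℚᵘ.*≡* cross) (ℚᵘ.≃-sym (frac≃ (a ℕ.+ b) k)))))
  where
  open Data.Integer.Solver.+-*-Solver
  cross : ((+ a) ℤ.* (+ suc k) ℤ.+ (+ b) ℤ.* (+ suc k)) ℤ.* (+ suc k)
        ≡ (+ (a ℕ.+ b)) ℤ.* ((+ suc k) ℤ.* (+ suc k))
  cross = trans (solve 3 (λ A B D → (A :* D :+ B :* D) :* D := (A :+ B) :* (D :* D))
                          refl (+ a) (+ b) (+ suc k))
                (cong (ℤ._* ((+ suc k) ℤ.* (+ suc k))) (ℤ.pos-+ a b))

frac-2/odd : ∀ m → frac 2 (odd m) ≡ frac 1 m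
frac-2/odd m = toℚᵘ-injective (ℚᵘ.≃-trans (frac≃ 2 (odd m))
  (ℚᵘ.≃-trans (ℚᵘ.*≡* (cong +_ cross)) (ℚᵘ.≃-sym (frac≃ 1 m))))
  where
  cross : 2 ℕ.* suc m ≡ 1 ℕ.* suc (suc (2 ℕ.* m))
  cross = trans (ℕ.*-distribˡ-+ 2 1 m) (sym (ℕ.*-identityˡ _))

frac-archimedean : ∀ a ε → 0ℚ < ε → Σ[ m ∈ ℕ ] frac a m < ε
frac-archimedean a (mkℚ +[1+ p ] d-1 _) _ = m ,
  toℚᵘ-cancel-< (ℚᵘ.<-respˡ-≃ (ℚᵘ.≃-sym (frac≃ a m))
    (ℚᵘ.*<* (subst₂ ℤ._<_ (ℤ.pos-* a (suc d-1)) (ℤ.pos-* (suc p) (suc m))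
      (ℤ.+<+ (ℕ.≤-trans (ℕ.n<1+n m) (ℕ.m≤n*m (suc m) (suc p)))))))
  where m = a ℕ.* suc d-1
frac-archimedean a (mkℚ (+ zero) _ _) (*<* (ℤ.+<+ ()))
frac-archimedean a (mkℚ -[1+ _ ] _ _) (*<* ())

∣p-q∣≡∣q-p∣ : ∀ p q → ∣ p - q ∣ ≡ ∣ q - p ∣
∣p-q∣≡∣q-p∣ p q = trans (sym (∣-p∣≡∣p∣ (p - q)))
  (cong ∣_∣ (solve 2 (λ x y → :- (x :- y) := y :- x) refl p q))
  where open Data.Rational.Solver.+-*-Solver

∣p-r∣≤∣p-q∣+∣q-r∣ : ∀ p q r → ∣ p - r ∣ ≤ ∣ p - q ∣ + ∣ q - r ∣
∣p-r∣≤∣p-q∣+∣q-r∣ p q r = subst (_≤ ∣ p - q ∣ + ∣ q - r ∣)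
  (cong ∣_∣ (solve 3 (λ x y z → (x :- y) :+ (y :- z) := x :- z) refl p q r))
  (∣p+q∣≤∣p∣+∣q∣ (p - q) (q - r))
  where open Data.Rational.Solver.+-*-Solver

+-cancelʳ-< : ∀ {p q} r → p + r < q + r → p < q
+-cancelʳ-< {p} {q} r p+r<q+r = begin-strict
  p              ≡⟨ solve 2 (λ p r → p := (p :+ r) :- r) refl p r ⟩
  (p + r) - r    <⟨ +-monoˡ-< (- r) p+r<q+r ⟩
  (q + r) - r    ≡⟨ solve 2 (λ q r → (q :+ r) :- r := q) refl q r ⟩
  q              ∎
  where
  open ≤-Reasoning
  open Data.Rational.Solver.+-*-Solver

p≤q+r⇒p-r≤q : ∀ {p q} r → p ≤ q + r → p - r ≤ q
p≤q+r⇒p-r≤q {p} {q} r p≤q+r = begin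
  p - r          ≤⟨ +-monoˡ-≤ (- r) p≤q+r ⟩
  (q + r) - r    ≡⟨ solve 2 (λ q r → (q :+ r) :- r := q) refl q r ⟩
  q              ∎
  where
  open ≤-Reasoning
  open Data.Rational.Solver.+-*-Solver

p<q⇒0<q-p : ∀ {p q} → p < q → 0ℚ < q - p
p<q⇒0<q-p {p} {q} p<q = subst (_< q - p) (+-inverseʳ p) (+-monoˡ-< (- p) p<q)

dist : ℝ → ℝ → ℕ → ℚ
dist x y k = ∣ seq x k - seq y k ∣

=ℝ-sym : ∀ {x y} → x =ℝ y → y =ℝ x
=ℝ-sym {x} {y} x=y k = subst (_≤ frac 2 k) (∣p-q∣≡∣q-p∣ (seq x k) (seq y k)) (x=y k)

≠ℝ-sym : ∀ {x y} → x ≠ℝ y → y ≠ℝ x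
≠ℝ-sym {x} {y} (n , gap) =
  n , subst (frac 1 n <_) (∣p-q∣≡∣q-p∣ (seq x (odd n)) (seq y (odd n))) gap

dist-=ℝ-estimate : ∀ {a a' b} → a' =ℝ a → ∀ n m →
                   dist a b (odd n) ≤ (dist a' b (odd m) + frac 2 m) + frac 1 n
dist-=ℝ-estimate {a} {a'} {b} a'=a n m = begin
  ∣ aN - bN ∣
    ≤⟨ ∣p-r∣≤∣p-q∣+∣q-r∣ aN aM bN ⟩
  ∣ aN - aM ∣ + ∣ aM - bN ∣
    ≤⟨ +-monoʳ-≤ ∣ aN - aM ∣ (∣p-r∣≤∣p-q∣+∣q-r∣ aM a'M bN) ⟩
  ∣ aN - aM ∣ + (∣ aM - a'M ∣ + ∣ a'M - bN ∣)
    ≤⟨ +-monoʳ-≤ ∣ aN - aM ∣ (+-monoʳ-≤ ∣ aM - a'M ∣ (∣p-r∣≤∣p-q∣+∣q-r∣ a'M bM bN)) ⟩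
  ∣ aN - aM ∣ + (∣ aM - a'M ∣ + (X + ∣ bM - bN ∣))
    ≤⟨ +-mono-≤ (reg a N M) (+-mono-≤ aM-a'M≤ (+-monoʳ-≤ X (reg b M N))) ⟩
  (fN + fM) + (frac 2 M + (X + (fM + fN)))
    ≡⟨ solve 4 (λ fN fM f2M X → (fN :+ fM) :+ (f2M :+ (X :+ (fM :+ fN)))
                                := (X :+ ((fM :+ fM) :+ f2M)) :+ (fN :+ fN))
               refl fN fM (frac 2 M) X ⟩
  (X + ((fM + fM) + frac 2 M)) + (fN + fN)
    ≡⟨ cong₂ (λ s t → (X + s) + t) two-halves (trans (frac-+ 1 1 N) (frac-2/odd n)) ⟩
  (X + frac 2 m) + frac 1 n
    ∎
  where
  open ≤-Reasoning
  open Data.Rational.Solver.+-*-Solver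
  N = odd n
  M = odd m
  aN = seq a N
  bN = seq b N
  aM = seq a M
  a'M = seq a' M
  bM = seq b M
  X = dist a' b M
  fN = frac 1 N
  fM = frac 1 M
  aM-a'M≤ : ∣ aM - a'M ∣ ≤ frac 2 M
  aM-a'M≤ = =ℝ-sym {a'} {a} a'=a M
  two-halves : (fM + fM) + frac 2 M ≡ frac 2 m
  two-halves = begin-equality
    (fM + fM) + frac 2 M    ≡⟨ cong (_+ frac 2 M) (frac-+ 1 1 M) ⟩
    frac 2 M + frac 2 M     ≡⟨ cong₂ _+_ (frac-2/odd m) (frac-2/odd m) ⟩
    frac 1 m + frac 1 m     ≡⟨ frac-+ 1 1 m ⟩
    frac 2 m                ∎

≠ℝ-respˡ-=ℝ : ∀ {a a' b} → a' =ℝ a → a ≠ℝ b → a' ≠ℝ b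
≠ℝ-respˡ-=ℝ {a} {a'} {b} a'=a (n , gap) = m , +-cancelʳ-< (frac 2 m) (<-≤-trans m-small
  (p≤q+r⇒p-r≤q (frac 1 n) (dist-=ℝ-estimate {a} {a'} {b} a'=a n m)))
  where
  archimedean : Σ[ m ∈ ℕ ] frac 3 m < dist a b (odd n) - frac 1 n
  archimedean = frac-archimedean 3 _ (p<q⇒0<q-p gap)
  m = proj₁ archimedean
  m-small : frac 1 m + frac 2 m < dist a b (odd n) - frac 1 n
  m-small = subst (_< _) (sym (frac-+ 1 2 m)) (proj₂ archimedean)

≠ℝ-resp-=ℝ : ∀ {a a' b b'} → a' =ℝ a → b' =ℝ b → a ≠ℝ b → a' ≠ℝ b'
≠ℝ-resp-=ℝ {a} {a'} {b} {b'} a'=a b'=b a≠b =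
  ≠ℝ-sym {b'} {a'} (≠ℝ-respˡ-=ℝ {b} {b'} {a'} b'=b
    (≠ℝ-sym {a'} {b} (≠ℝ-respˡ-=ℝ {a} {a'} {b} a'=a a≠b)))

module _ {X : SetIneq} (F : ExtSubset X) (sep : CompletelySeparated X F) (x y : Car X) where

  ≉⇒≠[F] : _≉_ X x y → x ≠[ F ] y
  ≉⇒≠[F] = proj₁ (proj₁ sep x y)

  ≠[F]⇒≉ : x ≠[ F ] y → _≉_ X x y
  ≠[F]⇒≉ = proj₂ (proj₁ sep x y)

module _ {I : SetIneq} {K : ExtSubset I} (S : Family I K) where
  private
    module I = IsEquivalence (isEq I)

  λ₁-inverseˡ : ∀ {i j} (p : _≈_ I i j) x → _≈_ (λ₀ S i) (λ₁ S (I.sym p) (λ₁ S p x)) x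
  λ₁-inverseˡ {i} p x = IsEquivalence.trans (isEq (λ₀ S i))
    (λ₁-comp S p (I.sym p) I.refl x) (λ₁-id S I.refl x)

  hatΦ-≠ℝ-transport : (Φ' : Π-set S) {i j : Car I} (p : _≈_ I i j)
                      (x : Car (λ₀ S i)) (b : ℝ) →
                      hatΦ S Φ' (i , x) ≠ℝ b ⇔ hatΦ S Φ' (j , λ₁ S p x) ≠ℝ b
  hatΦ-≠ℝ-transport Φ' {i} {j} p x b = mk⇔
    (λ ne → ≠ℝ-respˡ-=ℝ {a₂} {a₃} {b} e₃
              (≠ℝ-respˡ-=ℝ {a₁} {a₂} {b} e₂
                (≠ℝ-respˡ-=ℝ {a₀} {a₁} {b} e₁ ne)))
    (λ ne → ≠ℝ-respˡ-=ℝ {a₁} {a₀} {b} (=ℝ-sym {a₁} {a₀} e₁)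
              (≠ℝ-respˡ-=ℝ {a₂} {a₁} {b} (=ℝ-sym {a₂} {a₁} e₂)
                (≠ℝ-respˡ-=ℝ {a₃} {a₂} {b} (=ℝ-sym {a₃} {a₂} e₃) ne)))
    where
    Φᵢ = Π-set.Φ Φ' i
    x′ = λ₁ S p x
    a₀ = hatΦ S Φ' (i , x)
    a₁ = ap (proj₁ Φᵢ) (λ₁ S (I.sym p) x′)
    a₂ = ap (proj₁ (φ₁ S p Φᵢ)) x′
    a₃ = hatΦ S Φ' (j , x′)
    e₁ : a₁ =ℝ a₀
    e₁ = ext (proj₁ Φᵢ) (λ₁-inverseˡ p x)
    e₂ : a₂ =ℝ a₁
    e₂ = φ₁-def S p Φᵢ x′
    e₃ : a₃ =ℝ a₂
    e₃ = Π-set.dep Φ' p x′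

  HasEnoughSections : Set
  HasEnoughSections = ∀ (j : Car I) (h : Elem (F S j)) →
                      Σ[ Φ' ∈ Π-set S ] (proj₁ (Π-set.Φ Φ' j) =𝔽 proj₁ h)

  ≠KH⇒≠Σ : Discrete I → CompletelySeparated I K → ∀ z w → _≠KH_ S z w → _≠Σ_ S z w
  ≠KH⇒≠Σ _ sepI (i , x) (j , y) (inj₁ k-sep) = inj₁ (≠[F]⇒≉ K sepI i j k-sep)
  ≠KH⇒≠Σ disc _ (i , x) (j , y) (inj₂ (Φ' , Φ-sep)) with disc i j
  ... | inj₂ i≉j = inj₁ i≉j
  ... | inj₁ p = inj₂ (p , ≠[F]⇒≉ (F S j) (compSep S j) (λ₁ S p x) y
          (proj₁ Φⱼ , proj₂ Φⱼ ,
           Equivalence.to (hatΦ-≠ℝ-transport Φ' p x (ap (proj₁ Φⱼ) y)) Φ-sep))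
    where Φⱼ = Π-set.Φ Φ' j

  ≠Σ⇒≠KH : CompletelySeparated I K → HasEnoughSections → ∀ z w → _≠Σ_ S z w → _≠KH_ S z w
  ≠Σ⇒≠KH sepI _ (i , x) (j , y) (inj₁ i≉j) = inj₁ (≉⇒≠[F] K sepI i j i≉j)
  ≠Σ⇒≠KH _ enough (i , x) (j , y) (inj₂ (p , x′≉y))
    with ≉⇒≠[F] (F S j) (compSep S j) (λ₁ S p x) y x′≉y
  ... | h , h∈Fⱼ , h-sep with enough j (h , h∈Fⱼ)
  ... | Φ' , Φⱼ=h = inj₂ (Φ' , Equivalence.from (hatΦ-≠ℝ-transport Φ' p x (Φⱼ y))
          (≠ℝ-resp-=ℝ {ap h x′} {Φⱼ x′} {ap h y} {Φⱼ y} (Φⱼ=h x′) (Φⱼ=h y) h-sep))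
    where
    x′ = λ₁ S p x
    Φⱼ = ap (proj₁ (Π-set.Φ Φ' j))

proposition4p6 : (I : SetIneq) (K : ExtSubset I) →
    Discrete I → CompletelySeparated I K →
    (S : Family I K) →
    ((z w : ΣCar S) → _≠KH_ S z w → _≠Σ_ S z w)
    × ((∀ (j : Car I) (h : Elem (F S j)) →
          Σ[ Φ' ∈ Π-set S ] (proj₁ (Π-set.Φ Φ' j) =𝔽 proj₁ h))
       → (z w : ΣCar S) → _≠Σ_ S z w → _≠KH_ S z w)
proposition4p6 I K disc sepI S = ≠KH⇒≠Σ S disc sepI , λ enough → ≠Σ⇒≠KH S sepI enough
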